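{- Let $L$ be a frame and $I$ an interpretation with values in $L$ and nonempty domain $D$. Let $X$ be the set of all sequences over $D$ and $A$ the collection of all geometric formulae, and for $s\in X$, $\phi\in A$ put $gr(s\models\phi)=gr(s\ \mathrm{sat}\ \phi)$. Define $\phi\approx\psi$ iff $gr(s\models\phi)=gr(s\models\psi)$ for all $s\in X$; this is an equivalence relation, with classes $[\phi]$. Order $A/_{\approx}$ by $[\phi]\le[\psi]$ iff $gr(s\models\phi)\le gr(s\models\psi)$ for all $s\in X$. Then $A/_{\approx}$ is a frame, in which $[\phi]\wedge[\psi]=[\phi\wedge\psi]$ and $\bigvee_{i}[\phi_i]=[\bigvee\{\phi_i\}_{i}]$, and, with $gr(s\models'[\phi])=gr(s\models\phi)$ (well defined), the triple $(X,\models',A/_{\approx})$ is an $L$-topological system.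
   Context: A frame is a complete lattice $L$ (bottom $0_L$, top $1_L$) with $x\wedge\bigvee Y=\bigvee\{x\wedge y\mid y\in Y\}$. Language: constants $c_1,c_2,\dots$; variables $x_1,x_2,\dots$; $\top,\bot$; predicate symbols $p^i_j$ and function symbols $f^i_j$ of each arity $i>0$; identity $=$. Terms: constants, variables, $f^i_jt_1\dots t_i$. Geometric formulae: $\top$, $\bot$, $p^i_jt_1\dots t_i$, $(t=t')$, $(\phi\wedge\psi)$, $\bigvee\{\phi_i\}_{i\in I}$ for any indexed family, $\exists x_i\phi$. An interpretation $I$: a set $D$, $I(c_i)\in D$, $I(f^i_j):D^i\to D$, $I(p^i_j):D^i\to L$. Sequences $s=(s_1,s_2,\dots)$ over $D$; $s(d/x_k)$ replaces the $k$-th coordinate by $d$. Term evaluation: $s(c_i)=I(c_i)$, $s(x_k)=s_k$, $s(f^i_jt_1\dots t_i)=I(f^i_j)(s(t_1),\dots,s(t_i))$. Grade of satisfaction $gr(s\ \mathrm{sat}\ \phi)\in L$: atomic predicate gives $I(p^i_j)(s(t_1),\dots,s(t_i))$; $\top\mapsto1_L$; $\bot\mapsto0_L$; $t=t'\mapsto1_L$ if $s(t)=s(t')$ else $0_L$; $\wedge\mapsto$ meet; $\bigvee\{\phi_i\}\mapsto\sup_i gr(s\ \mathrm{sat}\ \phi_i)$; $\exists x_k\phi\mapsto\sup_{d\in D}gr(s(d/x_k)\ \mathrm{sat}\ \phi)$. An $L$-topological system is a triple $(X,\models,A)$ with $X$ a nonempty set, $A$ a frame and $\models:X\times A\to L$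 (written $gr(x\models a)$) such that for every finite $S\subseteq A$, $gr(x\models\bigwedge S)=\inf\{gr(x\models a)\mid a\in S\}$ (with $\bigwedge\emptyset=\top_A$ and $\inf\emptyset=1_L$), and for every $S\subseteq A$, $gr(x\models\bigvee S)=\sup\{gr(x\models a)\mid a\in S\}$. -}

module Defs where

open import Level using (Level; _⊔_) renaming (suc to lsuc; zero to lzero)
open import Data.Nat using (ℕ; zero; suc; _≡ᵇ_)
open import Data.Fin using (Fin)
import Data.Fin as Fin
open import Data.Bool using (if_then_else_)
open import Relation.Binary.Core using (Rel)
open import Relation.Binary.Structures using (IsPartialOrder)
open import Relation.Binary.PropositionalEquality using (_≡_)

-- Frames (predicative rendering: joins of all families indexed by a
-- type in Set; binary meets; top; bottom; infinite distributivity).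

record IsFrame {c ℓ₁ ℓ₂ : Level} {C : Set c}
               (_≈_ : Rel C ℓ₁) (_≤_ : Rel C ℓ₂)
               (⊤ ⊥ : C) (_∧_ : C → C → C)
               (⋁ : {I : Set} → (I → C) → C)
               : Set (lsuc lzero ⊔ c ⊔ ℓ₁ ⊔ ℓ₂) where
  field
    isPartialOrder : IsPartialOrder _≈_ _≤_
    ⊤-max   : ∀ x → x ≤ ⊤
    ⊥-min   : ∀ x → ⊥ ≤ x
    ∧-lb₁   : ∀ x y → (x ∧ y) ≤ x
    ∧-lb₂   : ∀ x y → (x ∧ y) ≤ y
    ∧-glb   : ∀ x y z → z ≤ x → z ≤ y → z ≤ (x ∧ y)
    ⋁-ub    : ∀ {I : Set} (f : I → C) (i : I) → f i ≤ ⋁ f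
    ⋁-lub   : ∀ {I : Set} (f : I → C) (z : C) → (∀ i → f i ≤ z) → ⋁ f ≤ z
    distrib : ∀ {I : Set} (x : C) (f : I → C) → (x ∧ ⋁ f) ≈ ⋁ (λ i → x ∧ f i)

record Frame (c ℓ₁ ℓ₂ : Level) : Set (lsuc (c ⊔ ℓ₁ ⊔ ℓ₂)) where
  field
    Carrier : Set c
    _≈_     : Rel Carrier ℓ₁
    _≤_     : Rel Carrier ℓ₂
    ⊤ ⊥     : Carrier
    _∧_     : Carrier → Carrier → Carrier
    ⋁       : {I : Set} → (I → Carrier) → Carrier
    isFrame : IsFrame _≈_ _≤_ ⊤ ⊥ _∧_ ⋁

  ⋀fin : ∀ {n} → (Fin n → Carrier) → Carrier
  ⋀fin {zero}  f = ⊤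
  ⋀fin {suc n} f = f Fin.zero ∧ ⋀fin (λ i → f (Fin.suc i))

-- Syntax.  Symbols of arity i>0 are indexed by (i , j) with arity suc i.
-- Variables x_k, constants c_k indexed by k : ℕ.

data Term : Set where
  const : ℕ → Term
  var   : ℕ → Term
  fun   : (i j : ℕ) → (Fin (suc i) → Term) → Term

data Formula : Set₁ where
  ⊤f    : Formula
  ⊥f    : Formula
  pred  : (i j : ℕ) → (Fin (suc i) → Term) → Formula
  _≐_   : Term → Term → Formula
  _∧f_  : Formula → Formula → Formula
  ⋁f    : {I : Set} → (I → Formula) → Formula
  ∃f    : ℕ → Formula → Formula

record Interpretation {c ℓ₁ ℓ₂} (L : Frame c ℓ₁ ℓ₂) (D : Set) : Set c where
  field
    constI : ℕ → D
    funI   : (i j : ℕ) → (Fin (suc i) → D) → D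
    predI  : (i j : ℕ) → (Fin (suc i) → D) → Frame.Carrier L

Seq : Set → Set
Seq D = ℕ → D

_[_↦_] : ∀ {D : Set} → Seq D → ℕ → D → Seq D
(s [ k ↦ d ]) m = if m ≡ᵇ k then d else s m

module Semantics {c ℓ₁ ℓ₂} (L : Frame c ℓ₁ ℓ₂) {D : Set}
                 (I : Interpretation L D) where
  open Frame L
  open Interpretation I

  evalT : Seq D → Term → D
  evalT s (const k)    = constI k
  evalT s (var k)      = s k
  evalT s (fun i j ts) = funI i j (λ k → evalT s (ts k))

  gr : Seq D → Formula → Carrier
  gr s ⊤f           = ⊤
  gr s ⊥f           = ⊥
  gr s (pred i j ts) = predI i j (λ k → evalT s (ts k))
  -- 1_L if s(t) = s(t'), 0_L otherwise, rendered constructively as the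
  -- join of 1_L over the proofs of s(t) = s(t')
  gr s (t ≐ t')     = ⋁ {evalT s t ≡ evalT s t'} (λ _ → ⊤)
  gr s (φ ∧f ψ)     = gr s φ ∧ gr s ψ
  gr s (⋁f φs)      = ⋁ (λ i → gr s (φs i))
  gr s (∃f k φ)     = ⋁ {D} (λ d → gr (s [ k ↦ d ]) φ)

  _≈φ_ : Rel Formula ℓ₁
  φ ≈φ ψ = ∀ (s : Seq D) → gr s φ ≈ gr s ψ

  _≤φ_ : Rel Formula ℓ₂
  φ ≤φ ψ = ∀ (s : Seq D) → gr s φ ≤ gr s ψ

  -- A/≈ as a frame (setoid of formulas), given its frame laws
  FormulaFrame : IsFrame _≈φ_ _≤φ_ ⊤f ⊥f _∧f_ ⋁f → Frame (lsuc lzero) ℓ₁ ℓ₂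
  FormulaFrame isF = record
    { Carrier = Formula ; _≈_ = _≈φ_ ; _≤_ = _≤φ_ ; ⊤ = ⊤f ; ⊥ = ⊥f
    ; _∧_ = _∧f_ ; ⋁ = ⋁f ; isFrame = isF }

record IsLTopSystem {c ℓ₁ ℓ₂ x a m₁ m₂} (L : Frame c ℓ₁ ℓ₂) (X : Set x)
                    (A : Frame a m₁ m₂)
                    (⊨ : X → Frame.Carrier A → Frame.Carrier L)
                    : Set (lsuc lzero ⊔ x ⊔ a ⊔ m₁ ⊔ ℓ₁) where
  private
    module L = Frame L
    module A = Frame A
  field
    nonempty  : X
    ⊨-resp    : ∀ (p : X) {u v : A.Carrier} → u A.≈ v → ⊨ p u L.≈ ⊨ p v
    ⊨-finMeet : ∀ (p : X) (n : ℕ) (f : Fin n → A.Carrier) →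
                ⊨ p (A.⋀fin f) L.≈ L.⋀fin (λ i → ⊨ p (f i))
    ⊨-join    : ∀ (p : X) {I : Set} (f : I → A.Carrier) →
                ⊨ p (A.⋁ f) L.≈ L.⋁ (λ i → ⊨ p (f i))

-- Each grade map gr s sends ⊤f, ⊥f, ∧f, ⋁f to ⊤, ⊥, ∧, ⋁ of L on the nose.
-- Ordering formulas pointwise through such a family of maps makes every
-- frame law for formulas a family of frame laws in L, and the satisfaction
-- relation preserves finite meets and joins by construction.
module Submission where

open import Level using (_⊔_)
open import Data.Product using (Σ; _,_)
open import Data.Nat using (zero; suc)
open import Data.Fin using (Fin)
import Data.Fin as Fin
open import Relation.Binary.Core using (Rel)
open import Relation.Binary.Bundles using (Setoid)
import Relation.Binary.Reasoning.Setoid as SetoidReasoning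
open import Relation.Binary.Structures using (IsPartialOrder; IsEquivalence)
open import Defs

module FrameProperties {c ℓ₁ ℓ₂} (L : Frame c ℓ₁ ℓ₂) where
  open Frame L
  open IsFrame isFrame
  open IsPartialOrder isPartialOrder

  ∧-cong : ∀ {x x' y y'} → x ≈ x' → y ≈ y' → (x ∧ y) ≈ (x' ∧ y')
  ∧-cong {x} {x'} {y} {y'} x≈x' y≈y' = antisym
    (∧-glb x' y' (x ∧ y) (≤-respʳ-≈ x≈x' (∧-lb₁ x y)) (≤-respʳ-≈ y≈y' (∧-lb₂ x y)))
    (∧-glb x y (x' ∧ y') (≤-respʳ-≈ (Eq.sym x≈x') (∧-lb₁ x' y'))
                         (≤-respʳ-≈ (Eq.sym y≈y') (∧-lb₂ x' y')))

  ≈-setoid : Setoid c ℓ₁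
  ≈-setoid = record { isEquivalence = isEquivalence }

  ⋁-cong : ∀ {I : Set} {f g : I → Carrier} → (∀ i → f i ≈ g i) → ⋁ f ≈ ⋁ g
  ⋁-cong {f = f} {g} f≈g = antisym
    (⋁-lub f (⋁ g) (λ i → ≤-respˡ-≈ (Eq.sym (f≈g i)) (⋁-ub g i)))
    (⋁-lub g (⋁ f) (λ i → ≤-respˡ-≈ (f≈g i) (⋁-ub f i)))

module Kernel {c ℓ₁ ℓ₂ x a} (L : Frame c ℓ₁ ℓ₂) {X : Set x} {A : Set a}
              (⊤A ⊥A : A) (_∧A_ : A → A → A) (⋁A : {I : Set} → (I → A) → A)
              (h : X → A → Frame.Carrier L) where
  open Frame L
  open IsFrame isFrame
  open IsPartialOrder isPartialOrder
  open FrameProperties L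
  open SetoidReasoning ≈-setoid

  _≈ₕ_ : Rel A (x ⊔ ℓ₁)
  u ≈ₕ v = ∀ p → h p u ≈ h p v

  _≤ₕ_ : Rel A (x ⊔ ℓ₂)
  u ≤ₕ v = ∀ p → h p u ≤ h p v

  ≈ₕ-isEquivalence : IsEquivalence _≈ₕ_
  ≈ₕ-isEquivalence = record
    { refl  = λ p → Eq.refl
    ; sym   = λ u≈v p → Eq.sym (u≈v p)
    ; trans = λ u≈v v≈w p → Eq.trans (u≈v p) (v≈w p)
    }

  ≤ₕ-isPartialOrder : IsPartialOrder _≈ₕ_ _≤ₕ_
  ≤ₕ-isPartialOrder = record
    { isPreorder = record
        { isEquivalence = ≈ₕ-isEquivalence
        ; reflexive     = λ u≈v p → reflexive (u≈v p)
        ; trans         = λ u≤v v≤w p → trans (u≤v p) (v≤w p)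
        }
    ; antisym = λ u≤v v≤u p → antisym (u≤v p) (v≤u p)
    }

  module _ (h-⊤ : ∀ p → h p ⊤A ≈ ⊤) (h-⊥ : ∀ p → h p ⊥A ≈ ⊥)
           (h-∧ : ∀ p u v → h p (u ∧A v) ≈ (h p u ∧ h p v))
           (h-⋁ : ∀ p {I : Set} (f : I → A) → h p (⋁A f) ≈ ⋁ (λ i → h p (f i)))
           where

    kernel-isFrame : IsFrame _≈ₕ_ _≤ₕ_ ⊤A ⊥A _∧A_ ⋁A
    kernel-isFrame = record
      { isPartialOrder = ≤ₕ-isPartialOrder
      ; ⊤-max   = λ u p → ≤-respʳ-≈ (Eq.sym (h-⊤ p)) (⊤-max (h p u))
      ; ⊥-min   = λ u p → ≤-respˡ-≈ (Eq.sym (h-⊥ p)) (⊥-min (h p u))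
      ; ∧-lb₁   = λ u v p → ≤-respˡ-≈ (Eq.sym (h-∧ p u v)) (∧-lb₁ (h p u) (h p v))
      ; ∧-lb₂   = λ u v p → ≤-respˡ-≈ (Eq.sym (h-∧ p u v)) (∧-lb₂ (h p u) (h p v))
      ; ∧-glb   = λ u v w w≤u w≤v p →
          ≤-respʳ-≈ (Eq.sym (h-∧ p u v)) (∧-glb (h p u) (h p v) (h p w) (w≤u p) (w≤v p))
      ; ⋁-ub    = λ f i p → ≤-respʳ-≈ (Eq.sym (h-⋁ p f)) (⋁-ub (λ j → h p (f j)) i)
      ; ⋁-lub   = λ f w f≤w p →
          ≤-respˡ-≈ (Eq.sym (h-⋁ p f)) (⋁-lub (λ j → h p (f j)) (h p w) (λ i → f≤w i p))
      ; distrib = kernel-distrib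
      }
      where
      kernel-distrib : ∀ {I : Set} u (f : I → A) → (u ∧A ⋁A f) ≈ₕ ⋁A (λ i → u ∧A f i)
      kernel-distrib u f p = begin
        h p (u ∧A ⋁A f)                ≈⟨ h-∧ p u (⋁A f) ⟩
        h p u ∧ h p (⋁A f)             ≈⟨ ∧-cong Eq.refl (h-⋁ p f) ⟩
        h p u ∧ ⋁ (λ i → h p (f i))    ≈⟨ distrib (h p u) (λ i → h p (f i)) ⟩
        ⋁ (λ i → h p u ∧ h p (f i))    ≈⟨ ⋁-cong (λ i → h-∧ p u (f i)) ⟨
        ⋁ (λ i → h p (u ∧A f i))       ≈⟨ h-⋁ p (λ i → u ∧A f i) ⟨
        h p (⋁A (λ i → u ∧A f i))      ∎

module _ {a m₁ m₂ c ℓ₁ ℓ₂} (A : Frame a m₁ m₂) (L : Frame c ℓ₁ ℓ₂)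
         (h : Frame.Carrier A → Frame.Carrier L) where
  private
    module A = Frame A
  open Frame L
  open IsFrame isFrame
  open IsPartialOrder isPartialOrder
  open FrameProperties L

  ⋀fin-preserved : h A.⊤ ≈ ⊤ → (∀ u v → h (u A.∧ v) ≈ (h u ∧ h v)) →
                   ∀ n (f : Fin n → A.Carrier) → h (A.⋀fin f) ≈ ⋀fin (λ i → h (f i))
  ⋀fin-preserved h-⊤ h-∧ zero    f = h-⊤
  ⋀fin-preserved h-⊤ h-∧ (suc n) f = Eq.trans (h-∧ (f Fin.zero) _)
    (∧-cong Eq.refl (⋀fin-preserved h-⊤ h-∧ n (λ i → f (Fin.suc i))))

theorem7 : ∀ {c ℓ₁ ℓ₂} (L : Frame c ℓ₁ ℓ₂) (D : Set) (I : Interpretation L D) → D →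
    Σ (IsFrame (Semantics._≈φ_ L I) (Semantics._≤φ_ L I) ⊤f ⊥f _∧f_ ⋁f)
      (λ isF → IsLTopSystem L (Seq D) (Semantics.FormulaFrame L I isF) (Semantics.gr L I))
theorem7 L D I d = isF , record
  { nonempty  = λ _ → d
  ; ⊨-resp    = λ s φ≈ψ → φ≈ψ s
  ; ⊨-finMeet = λ s → ⋀fin-preserved (FormulaFrame isF) L (gr s) Eq.refl (λ _ _ → Eq.refl)
  ; ⊨-join    = λ s f → Eq.refl
  }
  where
  open Frame L
  open IsFrame isFrame
  open IsPartialOrder isPartialOrder
  open Semantics L I

  isF : IsFrame _≈φ_ _≤φ_ ⊤f ⊥f _∧f_ ⋁f
  isF = Kernel.kernel-isFrame L ⊤f ⊥f _∧f_ ⋁f gr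
          (λ _ → Eq.refl) (λ _ → Eq.refl) (λ _ _ _ → Eq.refl) (λ _ _ → Eq.refl)
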